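{- If $G$ is $(p\!:\!q)$-colourable with clustering $c_1$ and $H$ is $(p\!:\!r)$-colourable with clustering $c_2$, then $G\boxtimes H$ is $(p\!:\!(q+r-p))$-colourable with clustering $c_1c_2$.
   Context: $\boxtimes$ is the strong product (vertex set $V(A)\times V(B)$; distinct $(v,x),(w,y)$ adjacent iff ($v=w$, $xy\in E(B)$) or ($x=y$, $vw\in E(A)$) or ($vw\in E(A)$, $xy\in E(B)$)). A $(p\!:\!q)$-colouring assigns to each vertex a $q$-subset of a palette of $p$ colours. A monochromatic component for colour $\alpha$ is a connected component of the subgraph induced by the vertices whose set contains $\alpha$; clustering $c$ means every monochromatic component has at most $c$ vertices. -}

module Defs where

open import Data.Nat using (ℕ; _≤_)
open import Data.Fin using (Fin)
open import Data.Fin.Subset using (Subset; _∈_; ∣_∣)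
open import Data.Product using (_×_; _,_)
open import Data.Sum using (_⊎_)
open import Data.List using (List; length)
open import Data.List.Relation.Unary.All using (All)
open import Data.List.Relation.Unary.Unique.Propositional using (Unique)
open import Relation.Binary.PropositionalEquality using (_≡_)
open import Relation.Binary.Construct.Closure.ReflexiveTransitive using (Star)
open import Relation.Nullary using (¬_)

record Graph : Set₁ where
  field
    V       : Set
    Adj     : V → V → Set
    adj-sym    : ∀ {x y} → Adj x y → Adj y x
    adj-irrefl : ∀ {x} → ¬ Adj x x
open Graph public

_⊠_ : Graph → Graph → Graph
A ⊠ B = record
  { V      = V A × V B
  ; Adj    = adj
  ; adj-sym    = sy
  ; adj-irrefl = irr
  }
  where
  adj : V A × V B → V A × V B → Set
  adj (v , x) (w , y) =
    ((v ≡ w) × Adj B x y) ⊎ (((x ≡ y) × Adj A v w) ⊎ (Adj A v w × Adj B x y))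
  open import Data.Sum using (inj₁; inj₂)
  open import Relation.Binary.PropositionalEquality renaming (sym to ≡-sym) using ()
  sy : ∀ {a b} → adj a b → adj b a
  sy (inj₁ (e , b)) = inj₁ (≡-sym e , Graph.adj-sym B b)
  sy (inj₂ (inj₁ (e , a))) = inj₂ (inj₁ (≡-sym e , Graph.adj-sym A a))
  sy (inj₂ (inj₂ (a , b))) = inj₂ (inj₂ (Graph.adj-sym A a , Graph.adj-sym B b))
  irr : ∀ {a} → ¬ adj a a
  irr (inj₁ (_ , b)) = Graph.adj-irrefl B b
  irr (inj₂ (inj₁ (_ , a))) = Graph.adj-irrefl A a
  irr (inj₂ (inj₂ (a , _))) = Graph.adj-irrefl A a

record Colouring (G : Graph) (p q : ℕ) : Set where
  field
    col    : V G → Subset p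
    size   : ∀ v → ∣ col v ∣ ≡ q
open Colouring public

module _ {G : Graph} {p q : ℕ} (φ : Colouring G p q) (α : Fin p) where
  MonoEdge : V G → V G → Set
  MonoEdge x y = (α ∈ col φ x) × (Adj G x y × (α ∈ col φ y))

  MonoConn : V G → V G → Set
  MonoConn v w = (α ∈ col φ v) × Star MonoEdge v w

-- Clustering c: every monochromatic component has at most c vertices,
-- i.e. every finite list of distinct vertices in one component has length ≤ c.
HasClustering : {G : Graph} {p q : ℕ} → Colouring G p q → ℕ → Set
HasClustering {G} {p} φ c =
  ∀ (α : Fin p) (v : V G) (ws : List (V G)) →
    Unique ws → All (MonoConn φ α v) ws → length ws ≤ c

ColourableWithClustering : Graph → ℕ → ℕ → ℕ → Set
ColourableWithClustering G p q c =
  Data.Product.Σ (Colouring G p q) (λ φ → HasClustering φ c)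
  where import Data.Product

-- Colour (v , x) by a ((q + r) ∸ p)-subset of φ v ∩ ψ x; the intersection is that large by
-- inclusion–exclusion. A monochromatic walk in G ⊠ H projects to monochromatic walks in G and
-- in H, so the monochromatic component of (v , x) lies inside C × D for the components C of v
-- and D of x, which has at most c₁ c₂ elements.
module Submission where

open import Defs
open import Data.Nat using (ℕ; zero; suc; _+_; _*_; _∸_; _≤_; z≤n; s≤s; _≤?_)
open import Data.Nat.Properties
  using (+-suc; +-mono-≤; +-monoʳ-≤; ≤-pred; ∸-monoˡ-≤; m+n∸n≡m; module ≤-Reasoning)
open import Data.Fin using (Fin)
open import Data.Fin.Subset using (Subset; _∈_; _⊆_; _∩_; _∪_; ∣_∣; ⊥; inside; outside)
open import Data.Fin.Subset.Properties using (⊥⊆; ∣⊥∣≡0; ∣p∣≤n; x∈p∩q⁻)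
open import Data.Vec using ([]; _∷_; here; there)
open import Data.Product using (∃₂; ∃-syntax; _×_; _,_; -,_; proj₁; proj₂)
open import Data.Sum using (inj₁; inj₂)
open import Data.List using (List; []; _∷_; [_]; length; map)
open import Data.List.Relation.Unary.All as All using (All; []; _∷_)
import Data.List.Relation.Unary.All.Properties as All
open import Data.List.Relation.Unary.AllPairs using ([]; _∷_)
open import Data.List.Relation.Unary.Unique.Propositional using (Unique)
import Data.List.Relation.Unary.Unique.Propositional.Properties as Unique
open import Data.List.Relation.Binary.Sublist.Propositional using ([]; _∷_; _∷ʳ_)
  renaming (_⊆_ to _⊑_)
open import Data.List.Relation.Binary.Sublist.Propositional.Properties using (All-resp-⊆)
open import Data.List.Relation.Ternary.Interleaving using (Interleaving; []; _∷ˡ_; _∷ʳ_)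
open import Data.List.Relation.Ternary.Interleaving.Properties using (interleave-length)
open import Effect.Monad using (RawMonad)
open import Level using (0ℓ)
open import Relation.Binary.PropositionalEquality using (_≡_; _≢_; refl; sym; trans; cong)
open import Relation.Binary.Construct.Closure.ReflexiveTransitive
  using (Star; ε; _◅_; kleisliStar)
open import Relation.Nullary using (¬_; Dec; yes; no; contradiction)
open import Relation.Nullary.Decidable using (decidable-stable; ¬¬-excluded-middle)
open import Relation.Nullary.Negation using (¬¬-Monad)
open import Relation.Unary using (Pred; _⟨×⟩_)

open RawMonad (¬¬-Monad {0ℓ}) using (pure; _>>=_)

∣p∩q∣+∣p∪q∣≡∣p∣+∣q∣ : ∀ {n} (p q : Subset n) → ∣ p ∩ q ∣ + ∣ p ∪ q ∣ ≡ ∣ p ∣ + ∣ q ∣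
∣p∩q∣+∣p∪q∣≡∣p∣+∣q∣ [] [] = refl
∣p∩q∣+∣p∪q∣≡∣p∣+∣q∣ (inside ∷ p) (inside ∷ q) =
  cong suc (trans (+-suc ∣ p ∩ q ∣ ∣ p ∪ q ∣)
                  (trans (cong suc (∣p∩q∣+∣p∪q∣≡∣p∣+∣q∣ p q)) (sym (+-suc ∣ p ∣ ∣ q ∣))))
∣p∩q∣+∣p∪q∣≡∣p∣+∣q∣ (inside ∷ p) (outside ∷ q) =
  trans (+-suc ∣ p ∩ q ∣ ∣ p ∪ q ∣) (cong suc (∣p∩q∣+∣p∪q∣≡∣p∣+∣q∣ p q))
∣p∩q∣+∣p∪q∣≡∣p∣+∣q∣ (outside ∷ p) (inside ∷ q) =
  trans (+-suc ∣ p ∩ q ∣ ∣ p ∪ q ∣)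
        (trans (cong suc (∣p∩q∣+∣p∪q∣≡∣p∣+∣q∣ p q)) (sym (+-suc ∣ p ∣ ∣ q ∣)))
∣p∩q∣+∣p∪q∣≡∣p∣+∣q∣ (outside ∷ p) (outside ∷ q) = ∣p∩q∣+∣p∪q∣≡∣p∣+∣q∣ p q

∣p∣+∣q∣∸n≤∣p∩q∣ : ∀ {n} (p q : Subset n) → (∣ p ∣ + ∣ q ∣) ∸ n ≤ ∣ p ∩ q ∣
∣p∣+∣q∣∸n≤∣p∩q∣ {n} p q = begin
  (∣ p ∣ + ∣ q ∣) ∸ n          ≡⟨ cong (_∸ n) (sym (∣p∩q∣+∣p∪q∣≡∣p∣+∣q∣ p q)) ⟩
  (∣ p ∩ q ∣ + ∣ p ∪ q ∣) ∸ n  ≤⟨ ∸-monoˡ-≤ n (+-monoʳ-≤ ∣ p ∩ q ∣ (∣p∣≤n (p ∪ q))) ⟩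
  (∣ p ∩ q ∣ + n) ∸ n          ≡⟨ m+n∸n≡m ∣ p ∩ q ∣ n ⟩
  ∣ p ∩ q ∣                    ∎
  where open ≤-Reasoning

⊆-ofSize : ∀ {n} (p : Subset n) k → k ≤ ∣ p ∣ → ∃[ t ] t ⊆ p × ∣ t ∣ ≡ k
⊆-ofSize {n} p zero _ = ⊥ , ⊥⊆ , ∣⊥∣≡0 n
⊆-ofSize (outside ∷ p) (suc k) k<∣p∣ with ⊆-ofSize p (suc k) k<∣p∣
... | t , t⊆p , ∣t∣≡k = outside ∷ t , (λ { (there x∈t) → there (t⊆p x∈t) }) , ∣t∣≡k
⊆-ofSize (inside ∷ p) (suc k) (s≤s k≤∣p∣) with ⊆-ofSize p k k≤∣p∣
... | t , t⊆p , ∣t∣≡k =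
  inside ∷ t , (λ { here → here ; (there x∈t) → there (t⊆p x∈t) }) , cong suc ∣t∣≡k

AtMost : {X : Set} → ℕ → Pred X _ → Set
AtMost {X} c S = ∀ (xs : List X) → Unique xs → All S xs → length xs ≤ c

AtMost-anti : ∀ {X : Set} {c} {P Q : Pred X _} →
              (∀ {x} → P x → Q x) → AtMost c Q → AtMost c P
AtMost-anti P⇒Q bQ xs u pxs = bQ xs u (All.map P⇒Q pxs)

AtMost-remove : ∀ {X : Set} {c} {S : Pred X _} {a} →
                S a → AtMost (suc c) S → AtMost c (λ x → S x × x ≢ a)
AtMost-remove sa bS xs u sxs =
  ≤-pred (bS (_ ∷ xs) (All.map (λ (_ , x≢a) a≡x → x≢a (sym a≡x)) sxs ∷ u)
                      (sa ∷ All.map proj₁ sxs))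

Unique-resp-⊇ : ∀ {X : Set} {xs ys : List X} → ys ⊑ xs → Unique xs → Unique ys
Unique-resp-⊇ [] [] = []
Unique-resp-⊇ (_ ∷ʳ ys⊑xs) (_ ∷ u) = Unique-resp-⊇ ys⊑xs u
Unique-resp-⊇ (refl ∷ ys⊑xs) (x∉xs ∷ u) = All-resp-⊆ ys⊑xs x∉xs ∷ Unique-resp-⊇ ys⊑xs u

module _ {A B : Set} (a : A) where

  -- L interleaves the fibre map (a ,_) F over a with the pairs R off that fibre.
  FibreSplit : List B → List (A × B) → List (A × B) → Set
  FibreSplit F R L = Interleaving (λ b z → (a , b) ≡ z) (λ z z′ → z ≡ z′ × proj₁ z ≢ a) F R L

  fibre⊑ : ∀ {F R L} → FibreSplit F R L → map (a ,_) F ⊑ L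
  fibre⊑ [] = []
  fibre⊑ (refl ∷ˡ sp) = refl ∷ fibre⊑ sp
  fibre⊑ (_ ∷ʳ sp) = _ ∷ʳ fibre⊑ sp

  rest⊑ : ∀ {F R L} → FibreSplit F R L → R ⊑ L
  rest⊑ [] = []
  rest⊑ (_ ∷ˡ sp) = _ ∷ʳ rest⊑ sp
  rest⊑ ((refl , _) ∷ʳ sp) = refl ∷ rest⊑ sp

  rest≢ : ∀ {F R L} → FibreSplit F R L → All (λ z → proj₁ z ≢ a) R
  rest≢ [] = []
  rest≢ (_ ∷ˡ sp) = rest≢ sp
  rest≢ ((refl , z≢a) ∷ʳ sp) = z≢a ∷ rest≢ sp

  -- Equality on A need not be decidable, so the split only exists in the double-negation monad.
  ¬¬-fibreSplit : ∀ L → ¬ ¬ ∃₂ λ F R → FibreSplit F R L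
  ¬¬-fibreSplit [] = pure (-, -, [])
  ¬¬-fibreSplit ((a′ , b) ∷ L) = do
    a′≟a ← ¬¬-excluded-middle
    (_ , _ , sp) ← ¬¬-fibreSplit L
    pure (extend a′≟a sp)
    where
    extend : ∀ {F R} → Dec (a′ ≡ a) → FibreSplit F R L →
             ∃₂ λ F′ R′ → FibreSplit F′ R′ ((a′ , b) ∷ L)
    extend (yes refl) sp = -, -, refl ∷ˡ sp
    extend (no a′≢a) sp = -, -, (refl , a′≢a) ∷ʳ sp

-- Induction on c₁: split L into the fibre over its first abscissa a (at most c₂ pairs)
-- and the rest, whose abscissae satisfy S and avoid a.
¬¬-AtMost-× : ∀ {A B : Set} {S : Pred A _} {T : Pred B _} c₁ {c₂} →
              AtMost c₁ S → AtMost c₂ T →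
              ∀ L → Unique L → All (S ⟨×⟩ T) L → ¬ ¬ (length L ≤ c₁ * c₂)
¬¬-AtMost-× c₁ bS bT [] u st = pure z≤n
¬¬-AtMost-× zero bS bT ((a , _) ∷ _) u ((sa , _) ∷ _) =
  contradiction (bS [ a ] ([] ∷ []) (sa ∷ [])) λ ()
¬¬-AtMost-× (suc c₁) {c₂} bS bT L@((a , _) ∷ _) u st@((sa , _) ∷ _) = do
  (F , R , sp) ← ¬¬-fibreSplit a L
  ∣R∣≤ ← ¬¬-AtMost-× c₁ (AtMost-remove sa bS) bT R (Unique-resp-⊇ (rest⊑ a sp) u) (rest-All sp)
  pure (begin
    length L             ≡⟨ interleave-length sp ⟩
    length F + length R  ≤⟨ +-mono-≤ (∣F∣≤ sp) ∣R∣≤ ⟩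
    c₂ + c₁ * c₂         ∎)
  where
  open ≤-Reasoning
  ∣F∣≤ : ∀ {F R} → FibreSplit a F R L → length F ≤ c₂
  ∣F∣≤ sp = bT _ (Unique.map⁻ (Unique-resp-⊇ (fibre⊑ a sp) u))
                 (All.map proj₂ (All.map⁻ (All-resp-⊆ (fibre⊑ a sp) st)))
  rest-All : ∀ {F R} → FibreSplit a F R L → All ((λ s → _ × s ≢ a) ⟨×⟩ _) R
  rest-All sp = All.zipWith (λ ((s , t) , z≢a) → (s , z≢a) , t)
                            (All-resp-⊆ (rest⊑ a sp) st , rest≢ a sp)

AtMost-× : ∀ {A B : Set} {S : Pred A _} {T : Pred B _} {c₁ c₂} →
           AtMost c₁ S → AtMost c₂ T → AtMost (c₁ * c₂) (S ⟨×⟩ T)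
AtMost-× {c₁ = c₁} {c₂} bS bT L u st =
  decidable-stable (length L ≤? c₁ * c₂) (¬¬-AtMost-× c₁ bS bT L u st)

module _ {G H : Graph} {p q r : ℕ} (φ : Colouring G p q) (ψ : Colouring H p r) where

  ⊠-colour : ∀ (z : V (G ⊠ H)) →
             ∃[ t ] t ⊆ col φ (proj₁ z) ∩ col ψ (proj₂ z) × ∣ t ∣ ≡ (q + r) ∸ p
  ⊠-colour (v , x) = ⊆-ofSize (col φ v ∩ col ψ x) ((q + r) ∸ p) large
    where
    large : (q + r) ∸ p ≤ ∣ col φ v ∩ col ψ x ∣
    large rewrite sym (size φ v) | sym (size ψ x) = ∣p∣+∣q∣∸n≤∣p∩q∣ (col φ v) (col ψ x)

  ⊠-colouring : Colouring (G ⊠ H) p ((q + r) ∸ p)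
  ⊠-colouring = record
    { col  = λ z → proj₁ (⊠-colour z)
    ; size = λ z → proj₂ (proj₂ (⊠-colour z))
    }

  module _ {α : Fin p} where

    ∈-⊠-colouring : ∀ {v x} → α ∈ col ⊠-colouring (v , x) → α ∈ col φ v × α ∈ col ψ x
    ∈-⊠-colouring {v} {x} α∈ = x∈p∩q⁻ (col φ v) (col ψ x) (proj₁ (proj₂ (⊠-colour (v , x))) α∈)

    ∈-⊠-colouring₁ : ∀ {v x} → α ∈ col ⊠-colouring (v , x) → α ∈ col φ v
    ∈-⊠-colouring₁ α∈ = proj₁ (∈-⊠-colouring α∈)

    ∈-⊠-colouring₂ : ∀ {v x} → α ∈ col ⊠-colouring (v , x) → α ∈ col ψ x
    ∈-⊠-colouring₂ α∈ = proj₂ (∈-⊠-colouring α∈)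

    MonoEdge-proj₁ : ∀ {z z′} → MonoEdge ⊠-colouring α z z′ →
                     Star (MonoEdge φ α) (proj₁ z) (proj₁ z′)
    MonoEdge-proj₁ (_ , inj₁ (refl , _) , _) = ε
    MonoEdge-proj₁ (α∈ , inj₂ (inj₁ (_ , e)) , α∈′) =
      (∈-⊠-colouring₁ α∈ , e , ∈-⊠-colouring₁ α∈′) ◅ ε
    MonoEdge-proj₁ (α∈ , inj₂ (inj₂ (e , _)) , α∈′) =
      (∈-⊠-colouring₁ α∈ , e , ∈-⊠-colouring₁ α∈′) ◅ ε

    MonoEdge-proj₂ : ∀ {z z′} → MonoEdge ⊠-colouring α z z′ →
                     Star (MonoEdge ψ α) (proj₂ z) (proj₂ z′)
    MonoEdge-proj₂ (α∈ , inj₁ (_ , e) , α∈′) =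
      (∈-⊠-colouring₂ α∈ , e , ∈-⊠-colouring₂ α∈′) ◅ ε
    MonoEdge-proj₂ (_ , inj₂ (inj₁ (refl , _)) , _) = ε
    MonoEdge-proj₂ (α∈ , inj₂ (inj₂ (_ , e)) , α∈′) =
      (∈-⊠-colouring₂ α∈ , e , ∈-⊠-colouring₂ α∈′) ◅ ε

    MonoConn-⊠ : ∀ {v x z} → MonoConn ⊠-colouring α (v , x) z →
                 (MonoConn φ α v ⟨×⟩ MonoConn ψ α x) z
    MonoConn-⊠ (α∈ , walk) =
      (∈-⊠-colouring₁ α∈ , kleisliStar proj₁ MonoEdge-proj₁ walk) ,
      (∈-⊠-colouring₂ α∈ , kleisliStar proj₂ MonoEdge-proj₂ walk)

mainTheorem7 : (G H : Graph) (p q r c₁ c₂ : ℕ) →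
    ColourableWithClustering G p q c₁ →
    ColourableWithClustering H p r c₂ →
    ColourableWithClustering (G ⊠ H) p ((q + r) ∸ p) (c₁ * c₂)
mainTheorem7 G H p q r c₁ c₂ (φ , φ-clustered) (ψ , ψ-clustered) =
  ⊠-colouring φ ψ , λ α (v , x) →
    AtMost-anti (MonoConn-⊠ φ ψ) (AtMost-× (φ-clustered α v) (ψ-clustered α x))
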